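{- Let $a$ be a positive integer. Then for every positive integer $n>14.4a$ there exist prime numbers $p$ and $q$ such that $n<ap<\frac{3n}{2}<aq<2n$.
   Context: All inequalities are strict. -}

module Defs where

-- Chebyshev's method with the weights of his 1852 memoir. The integer
--   F(n) = n! ⌊n/30⌋! / (⌊n/2⌋! ⌊n/3⌋! ⌊n/5⌋!)
-- has p-adic valuation Σᵢ w(⌊n/pⁱ⌋), where w(t) = t + ⌊t/30⌋ − ⌊t/2⌋ − ⌊t/3⌋ − ⌊t/5⌋ is
-- periodic mod 30 with values 0 and 1. Hence v_p(F n) ≤ ⌊log_p n⌋, and
-- ⌊log_p n⌋ ≤ v_p(F n) + ⌊log_p ⌊n/6⌋⌋; iterating the latter gives a multiple M(a) of
-- lcm(1, …, 30a) with M(a) ≤ 2¹¹⁰ 2⁵¹ᵃ. Pairing the linear factors of F(30m + 30)/F(30m)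
-- shows that this ratio is nondecreasing in m and at most 30³⁰/(15¹⁵ 10¹⁰ 6⁶) < 2⁴⁰; it
-- exceeds 9·10¹¹ from m = 5 on.
-- If there were no prime in (90j, 120(j − 1)], then for every prime p
--   v_p F(120(j − 1)) ≤ ⌊log_p 120(j − 1)⌋ ≤ ⌊log_p 90j⌋ + ⌊log_p 30⌊j/26⌋⌋,
-- so F(120(j − 1)) would divide M(3j) M(⌊j/26⌋), which the growth bounds forbid for j ≥ 600.
-- Below 54037 a chain of primes, each less than 4/3 of its predecessor, leaves no gap.
-- A prime in (k, 4k/3) for k = ⌊n/a⌋ and for k = ⌊3n/(2a)⌋ then gives p and q.

module Submission where

open import Defs
open import Data.Bool.Base using (if_then_else_)
open import Data.Nat
open import Data.Nat.Properties
open import Data.Nat.DivMod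
open import Data.Nat.Divisibility
open import Data.Nat.Induction using (<-rec)
open import Data.Nat.Primality
open import Data.Nat.Primality.Factorisation using (factorise; PrimeFactorisation)
open import Data.Nat.ListAction using (product)
open import Data.Nat.ListAction.Properties using (product≢0; product-++; product-↭)
open import Data.Nat.Tactic.RingSolver using (solve-∀)
open import Data.List.Base using (List; []; _∷_; _++_; map)
open import Data.List.Properties using (map-++)
open import Data.List.Relation.Unary.All as All using (All; []; _∷_; all?)
open import Data.List.Relation.Unary.Any using (Any; here; there)
open import Data.List.Relation.Unary.Linked using (Linked; _∷_; linked?)
open import Data.List.Membership.DecPropositional _≟_ using (_∈?_; lose)
open import Data.List.Relation.Binary.Permutation.Propositional using (_↭_; ↭-sym; ↭-trans; ↭-reflexive)
open import Data.List.Relation.Binary.Permutation.Propositional.Properties using (map⁺)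
open import Data.Product using (∃-syntax; Σ-syntax; _×_; _,_; proj₁; proj₂)
open import Data.Product.Relation.Binary.Lex.NonStrict using (×-decTotalOrder)
open import Data.List.Sort.InsertionSort.Base (×-decTotalOrder ≤-decTotalOrder ≤-decTotalOrder)
  using (sort)
open import Data.List.Sort.InsertionSort.Properties (×-decTotalOrder ≤-decTotalOrder ≤-decTotalOrder)
  using (sort-↭)
open import Data.Sum using (_⊎_; inj₁; inj₂)
open import Relation.Nullary using (¬_; Dec; yes; no; ¬?; contradiction)
open import Relation.Nullary.Decidable using (from-yes; _×-dec_; _→-dec_)
open import Relation.Binary.PropositionalEquality

m*n*o≡m*o*n : ∀ m n o → m * n * o ≡ m * o * n
m*n*o≡m*o*n = solve-∀

m*[n*o]≡n*[m*o] : ∀ m n o → m * (n * o) ≡ n * (m * o)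
m*[n*o]≡n*[m*o] = solve-∀

[m+n]+[o+p]≡[m+o]+[n+p] : ∀ m n o p → (m + n) + (o + p) ≡ (m + o) + (n + p)
[m+n]+[o+p]≡[m+o]+[n+p] = solve-∀

infix 4 _^_∥_

record _^_∥_ (p k n : ℕ) : Set where
  constructor exactly
  field
    cofactor   : ℕ
    equation   : n ≡ p ^ k * cofactor
    p∤cofactor : ¬ p ∣ cofactor

valuationWithFuel : ℕ → ℕ → ℕ → ℕ
valuationWithFuel zero    p n = 0
valuationWithFuel (suc f) p n with p ∣? n
... | yes (divides q _) = suc (valuationWithFuel f p q)
... | no  _             = 0

valuation : ℕ → ℕ → ℕ
valuation p n = valuationWithFuel n p n

exactPower-suc : ∀ {p k n r} → n ≡ r * p → p ^ k ∥ r → p ^ suc k ∥ n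
exactPower-suc {p} {k} refl (exactly s refl p∤s) =
  exactly s (trans (*-comm (p ^ k * s) p) (sym (*-assoc p (p ^ k) s))) p∤s

valuationWithFuel-exact : ∀ f {p n} .{{_ : NonTrivial p}} .{{_ : NonZero n}} →
                          n ≤ f → p ^ valuationWithFuel f p n ∥ n
valuationWithFuel-exact zero    {n = suc _} ()
valuationWithFuel-exact (suc f) {p} {n} {{p>1}} n≤1+f with p ∣? n
... | yes p∣n@(divides q n≡q*p) = exactPower-suc {k = valuationWithFuel f p q} n≡q*p
  (valuationWithFuel-exact f {{p>1}} {{quotient≢0 p∣n}} (<⇒≤pred (≤-trans (quotient-< p∣n) n≤1+f)))
... | no  p∤n = exactly n (sym (*-identityˡ n)) p∤n

valuation-exact : ∀ p n .{{_ : NonTrivial p}} .{{_ : NonZero n}} → p ^ valuation p n ∥ n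
valuation-exact p n = valuationWithFuel-exact n ≤-refl

exactPower-unique : ∀ {p a b n} .{{_ : NonZero p}} → p ^ a ∥ n → p ^ b ∥ n → a ≡ b
exactPower-unique {p} {a} {b} (exactly r refl p∤r) (exactly s eq p∤s) = go a b eq
  where
  p∣p^[1+k]*t : ∀ k t → p ∣ p ^ suc k * t
  p∣p^[1+k]*t k t = subst (p ∣_) (sym (*-assoc p (p ^ k) t)) (m∣m*n (p ^ k * t))
  go : ∀ a b → p ^ a * r ≡ p ^ b * s → a ≡ b
  go zero    zero    _  = refl
  go zero    (suc b) eq = contradiction (subst (p ∣_) (trans (sym eq) (*-identityˡ r)) (p∣p^[1+k]*t b s)) p∤r
  go (suc a) zero    eq = contradiction (subst (p ∣_) (trans eq (*-identityˡ s)) (p∣p^[1+k]*t a r)) p∤s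
  go (suc a) (suc b) eq = cong suc (go a b (*-cancelˡ-≡ _ _ p
    (trans (sym (*-assoc p (p ^ a) r)) (trans eq (*-assoc p (p ^ b) s)))))

valuation-unique : ∀ {p k n} .{{_ : NonTrivial p}} .{{_ : NonZero n}} → p ^ k ∥ n → valuation p n ≡ k
valuation-unique {p} = exactPower-unique {{nonTrivial⇒nonZero p}} (valuation-exact p _)

exactPower-* : ∀ {p a b m n} → Prime p → p ^ a ∥ m → p ^ b ∥ n → p ^ (a + b) ∥ m * n
exactPower-* {p} {a} {b} pp (exactly r refl p∤r) (exactly s refl p∤s) =
  exactly (r * s) rearrange p∤r*s
  where
  rearrange : p ^ a * r * (p ^ b * s) ≡ p ^ (a + b) * (r * s)
  rearrange = trans ([m*n]*[o*p]≡[m*o]*[n*p] (p ^ a) r (p ^ b) s)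
                    (cong (_* (r * s)) (sym (^-distribˡ-+-* p a b)))
  p∤r*s : ¬ p ∣ r * s
  p∤r*s p∣r*s with euclidsLemma r s pp p∣r*s
  ... | inj₁ p∣r = p∤r p∣r
  ... | inj₂ p∣s = p∤s p∣s

module _ {p} (pp : Prime p) where
  private
    instance
      p>1 : NonTrivial p
      p>1 = prime⇒nonTrivial pp

    p∤1 : ¬ p ∣ 1
    p∤1 p∣1 = nonTrivial⇒≢1 (∣1⇒≡1 p∣1)

  valuation-* : ∀ m n .{{_ : NonZero m}} .{{_ : NonZero n}} →
                valuation p (m * n) ≡ valuation p m + valuation p n
  valuation-* m n = valuation-unique {{p>1}} {{m*n≢0 m n}}
    (exactPower-* pp (valuation-exact p m) (valuation-exact p n))

  valuation-self : valuation p p ≡ 1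
  valuation-self = valuation-unique {{p>1}} {{prime⇒nonZero pp}}
    (exactly 1 (sym (trans (*-identityʳ (p * 1)) (*-identityʳ p))) p∤1)

  valuation-1 : valuation p 1 ≡ 0
  valuation-1 = valuation-unique (exactly 1 refl p∤1)

  valuation>0⇒∣ : ∀ {n} .{{_ : NonZero n}} → 0 < valuation p n → p ∣ n
  valuation>0⇒∣ {n} _ with valuation p n | valuation-exact p n
  ... | suc k | exactly r refl _ = ∣m⇒∣m*n r (m∣m*n (p ^ k))

product-∣-by-valuations : ∀ {ps} → All Prime ps → ∀ n .{{_ : NonZero n}} →
  (∀ {q} → Prime q → valuation q (product ps) ≤ valuation q n) → product ps ∣ n
product-∣-by-valuations []                 n _  = 1∣ n
product-∣-by-valuations {p ∷ ps} (pp ∷ pps) n v≤ =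
  subst (p * P ∣_) (sym n≡p*n′) (*-monoʳ-∣ p (product-∣-by-valuations pps n′ v≤′))
  where
  P = product ps
  instance
    p≢0 : NonZero p
    p≢0 = prime⇒nonZero pp
    P≢0 : NonZero P
    P≢0 = product≢0 (All.map prime⇒nonZero pps)
  p∣n : p ∣ n
  p∣n = valuation>0⇒∣ pp (begin
    1                                  ≤⟨ m≤m+n 1 _ ⟩
    1 + valuation p P                  ≡⟨ cong (_+ valuation p P) (valuation-self pp) ⟨
    valuation p p + valuation p P      ≡⟨ valuation-* pp p P ⟨
    valuation p (p * P)                ≤⟨ v≤ pp ⟩
    valuation p n                      ∎)
    where open ≤-Reasoning
  n′ = quotient p∣n
  n≡p*n′ = m∣n⇒n≡m*quotient p∣n
  instance
    n′≢0 : NonZero n′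
    n′≢0 = quotient≢0 p∣n
  v≤′ : ∀ {q} → Prime q → valuation q P ≤ valuation q n′
  v≤′ {q} qq = +-cancelˡ-≤ (valuation q p) _ _ (begin
    valuation q p + valuation q P      ≡⟨ valuation-* qq p P ⟨
    valuation q (p * P)                ≤⟨ v≤ qq ⟩
    valuation q n                      ≡⟨ cong (valuation q) n≡p*n′ ⟩
    valuation q (p * n′)               ≡⟨ valuation-* qq p n′ ⟩
    valuation q p + valuation q n′     ∎)
    where open ≤-Reasoning

∣-by-valuations : ∀ m n .{{_ : NonZero m}} .{{_ : NonZero n}} →
  (∀ {q} → Prime q → valuation q m ≤ valuation q n) → m ∣ n
∣-by-valuations m n v≤ = subst (_∣ n) (sym isFactorisation) (product-∣-by-valuations factorsPrime n
  (λ {q} qq → subst (λ k → valuation q k ≤ valuation q n) isFactorisation (v≤ qq)))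
  where open PrimeFactorisation (factorise m)

-- Legendre's formula

[r+q*d]/d≡q : ∀ {d} .{{_ : NonZero d}} r q → r < d → (r + q * d) / d ≡ q
[r+q*d]/d≡q {d} r q r<d =
  trans (+-distrib-/-∣ʳ r (n∣m*n q)) (cong₂ _+_ (m<n⇒m/n≡0 r<d) (m*n/n≡m q d))

m/n/o≡m/o/n : ∀ m n o .{{_ : NonZero n}} .{{_ : NonZero o}} → m / n / o ≡ m / o / n
m/n/o≡m/o/n m n o = begin
  m / n / o   ≡⟨ m/n/o≡m/[n*o] m n o ⟩
  m / (n * o) ≡⟨ /-congʳ (*-comm n o) ⟩
  m / (o * n) ≡⟨ m/n/o≡m/[n*o] m o n ⟨
  m / o / n   ∎
  where
  open ≡-Reasoning
  instance
    n*o≢0 = m*n≢0 n o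
    o*n≢0 = m*n≢0 o n

[1+m]/n≡m/n : ∀ m n .{{_ : NonZero n}} → ¬ n ∣ suc m → suc m / n ≡ m / n
[1+m]/n≡m/n m n n∤1+m with suc m % n in r≡ | m≡m%n+[m/n]*n (suc m) n | m%n<n (suc m) n
... | zero  | _    | _     = contradiction (m%n≡0⇒n∣m (suc m) n r≡) n∤1+m
... | suc r | 1+m≡ | 1+r<n =
  sym (trans (/-congˡ (suc-injective 1+m≡)) ([r+q*d]/d≡q r _ (<-trans (n<1+n r) 1+r<n)))

[1+m]/n≡1+[m/n] : ∀ m n .{{_ : NonZero n}} → n ∣ suc m → suc m / n ≡ suc (m / n)
[1+m]/n≡1+[m/n] m n@(suc n-1) (divides (suc q) 1+m≡) = trans (/-congˡ 1+m≡) (trans (m*n/n≡m (suc q) n)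
  (cong suc (sym (trans (/-congˡ (suc-injective 1+m≡)) ([r+q*d]/d≡q n-1 q ≤-refl)))))

/-rec : ∀ d .{{_ : NonZero d}} → 1 < d → (P : ℕ → Set) →
        P 0 → (∀ n → P (suc n / d) → P (suc n)) → ∀ n → P n
/-rec d 1<d P P0 step = <-rec P rec
  where
  rec : ∀ n → (∀ {m} → m < n → P m) → P n
  rec zero    _  = P0
  rec (suc n) ih = step n (ih (m/n<m (suc n) d 1<d))

module _ {p} (pp : Prime p) where
  private
    instance
      p>1 : NonTrivial p
      p>1 = prime⇒nonTrivial pp
      p≢0 : NonZero p
      p≢0 = prime⇒nonZero pp
    v = valuation p

  valuation-! : ∀ n → v (n !) ≡ n / p + v ((n / p) !)
  valuation-! zero = sym (cong (λ t → t + v (t !)) (0/n≡0 p))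
  valuation-! (suc n) with p ∣? suc n
  ... | no p∤1+n = begin
    v (suc n * n !)                   ≡⟨ valuation-* pp (suc n) (n !) {{_}} {{n !≢0}} ⟩
    v (suc n) + v (n !)               ≡⟨ cong₂ _+_ v[1+n]≡0 (valuation-! n) ⟩
    n / p + v ((n / p) !)             ≡⟨ cong (λ t → t + v (t !)) ([1+m]/n≡m/n n p p∤1+n) ⟨
    suc n / p + v ((suc n / p) !)     ∎
    where
    open ≡-Reasoning
    v[1+n]≡0 : v (suc n) ≡ 0
    v[1+n]≡0 = valuation-unique (exactly (suc n) (sym (*-identityˡ (suc n))) p∤1+n)
  ... | yes p∣1+n = begin
    v (suc n * n !)                   ≡⟨ valuation-* pp (suc n) (n !) {{_}} {{n !≢0}} ⟩
    v (suc n) + v (n !)               ≡⟨ cong₂ _+_ v[1+n] (valuation-! n) ⟩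
    (v (suc q) + 1) + (q + v (q !))   ≡⟨ rearrange (v (suc q)) q (v (q !)) ⟩
    suc q + (v (suc q) + v (q !))     ≡⟨ cong (suc q +_) (valuation-* pp (suc q) (q !) {{_}} {{q !≢0}}) ⟨
    suc q + v (suc q !)               ≡⟨ cong (λ t → t + v (t !)) [1+n]/p≡1+q ⟨
    suc n / p + v ((suc n / p) !)     ∎
    where
    open ≡-Reasoning
    q = n / p
    [1+n]/p≡1+q = [1+m]/n≡1+[m/n] n p p∣1+n
    v[1+n] : v (suc n) ≡ v (suc q) + 1
    v[1+n] = begin
      v (suc n)                 ≡⟨ cong v (m/n*n≡m p∣1+n) ⟨
      v (suc n / p * p)         ≡⟨ cong (λ t → v (t * p)) [1+n]/p≡1+q ⟩
      v (suc q * p)             ≡⟨ valuation-* pp (suc q) p ⟩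
      v (suc q) + v p           ≡⟨ cong (v (suc q) +_) (valuation-self pp) ⟩
      v (suc q) + 1             ∎
    rearrange : ∀ a b c → (a + 1) + (b + c) ≡ suc b + (a + c)
    rearrange = solve-∀

-- Chebyshev's quotient

numeratorSum denominatorSum : ℕ → ℕ
numeratorSum   t = t + t / 30
denominatorSum t = t / 2 + t / 3 + t / 5

chebyshevWeight : ℕ → ℕ
chebyshevWeight t = numeratorSum t ∸ denominatorSum t

ChebyshevWeightBounds : ℕ → Set
ChebyshevWeightBounds t = denominatorSum t ≤ numeratorSum t × numeratorSum t ≤ suc (denominatorSum t)

[m*30]/d : ∀ m {d k} .{{_ : NonZero d}} → k * d ≡ 30 → m * 30 / d ≡ m * k
[m*30]/d m {d} {k} k*d≡30 =
  trans (/-congˡ (trans (cong (m *_) (sym k*d≡30)) (sym (*-assoc m k d)))) (m*n/n≡m (m * k) d)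

[r+m*30]/d : ∀ r m {d k} .{{_ : NonZero d}} → k * d ≡ 30 → (r + m * 30) / d ≡ r / d + m * k
[r+m*30]/d r m {d} {k} k*d≡30 = trans (+-distrib-/-∣ʳ r d∣m*30) (cong (r / d +_) ([m*30]/d m k*d≡30))
  where d∣m*30 = divides (m * k) (trans (cong (m *_) (sym k*d≡30)) (sym (*-assoc m k d)))

numeratorSum-periodic : ∀ r m → numeratorSum (r + m * 30) ≡ numeratorSum r + m * 31
numeratorSum-periodic r m =
  trans (cong (r + m * 30 +_) ([r+m*30]/d r m {k = 1} refl)) (rearrange r (r / 30) m)
  where
  rearrange : ∀ a b m → a + m * 30 + (b + m * 1) ≡ a + b + m * 31
  rearrange = solve-∀

denominatorSum-periodic : ∀ r m → denominatorSum (r + m * 30) ≡ denominatorSum r + m * 31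
denominatorSum-periodic r m = trans
  (cong₂ _+_ (cong₂ _+_ ([r+m*30]/d r m {k = 15} refl) ([r+m*30]/d r m {k = 10} refl))
             ([r+m*30]/d r m {k = 6} refl))
  (rearrange (r / 2) (r / 3) (r / 5) m)
  where
  rearrange : ∀ a b c m → a + m * 15 + (b + m * 10) + (c + m * 6) ≡ a + b + c + m * 31
  rearrange = solve-∀

chebyshevWeightBounds-periodic : ∀ r m → ChebyshevWeightBounds r → ChebyshevWeightBounds (r + m * 30)
chebyshevWeightBounds-periodic r m (lower , upper) =
  subst₂ _≤_ (sym den) (sym num) (+-monoˡ-≤ (m * 31) lower) ,
  subst₂ _≤_ (sym num) (cong suc (sym den)) (+-monoˡ-≤ (m * 31) upper)
  where
  num = numeratorSum-periodic r m
  den = denominatorSum-periodic r m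

chebyshevWeightBounds<30 : ∀ {r} → r < 30 → ChebyshevWeightBounds r
chebyshevWeightBounds<30 = from-yes (allUpTo? (λ r →
  (denominatorSum r ≤? numeratorSum r) ×-dec (numeratorSum r ≤? suc (denominatorSum r))) 30)

chebyshevWeightBounds : ∀ t → ChebyshevWeightBounds t
chebyshevWeightBounds t = subst ChebyshevWeightBounds (sym (m≡m%n+[m/n]*n t 30))
  (chebyshevWeightBounds-periodic (t % 30) (t / 30) (chebyshevWeightBounds<30 (m%n<n t 30)))

numeratorSum≡weight+denominatorSum : ∀ t → numeratorSum t ≡ chebyshevWeight t + denominatorSum t
numeratorSum≡weight+denominatorSum t = sym (m∸n+n≡m (proj₁ (chebyshevWeightBounds t)))

heaviside : ℕ → ℕ
heaviside zero    = 0
heaviside (suc _) = 1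

heaviside-mono-≤ : ∀ {s t} → s ≤ t → heaviside s ≤ heaviside t
heaviside-mono-≤ {zero}          _ = z≤n
heaviside-mono-≤ {suc _} {suc _} _ = ≤-refl

heaviside≤1 : ∀ t → heaviside t ≤ 1
heaviside≤1 zero    = z≤n
heaviside≤1 (suc _) = ≤-refl

heaviside≤id : ∀ t → heaviside t ≤ t
heaviside≤id zero    = z≤n
heaviside≤id (suc _) = s≤s z≤n

chebyshevWeight≤heaviside : ∀ t → chebyshevWeight t ≤ heaviside t
chebyshevWeight≤heaviside zero    = z≤n
chebyshevWeight≤heaviside t@(suc _) = begin
  numeratorSum t ∸ denominatorSum t         ≤⟨ ∸-monoˡ-≤ (denominatorSum t) (proj₂ (chebyshevWeightBounds t)) ⟩
  suc (denominatorSum t) ∸ denominatorSum t ≡⟨ m+n∸n≡m 1 (denominatorSum t) ⟩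
  1                                         ∎
  where open ≤-Reasoning

heaviside≤weight+heaviside[/6] : ∀ t → heaviside t ≤ chebyshevWeight t + heaviside (t / 6)
heaviside≤weight+heaviside[/6] 0 = z≤n
heaviside≤weight+heaviside[/6] 1 = ≤-refl
heaviside≤weight+heaviside[/6] 2 = ≤-refl
heaviside≤weight+heaviside[/6] 3 = ≤-refl
heaviside≤weight+heaviside[/6] 4 = ≤-refl
heaviside≤weight+heaviside[/6] 5 = ≤-refl
heaviside≤weight+heaviside[/6] t@(suc (suc (suc (suc (suc (suc u)))))) =
  ≤-trans (heaviside-mono-≤ (m≥n⇒m/n>0 {t} {6} (m≤m+n 6 u))) (m≤n+m _ _)

chebyshevNumerator chebyshevDenominator : ℕ → ℕ
chebyshevNumerator   n = n ! * (n / 30) !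
chebyshevDenominator n = (n / 2) ! * (n / 3) ! * (n / 5) !

chebyshevNumerator≢0 : ∀ n → NonZero (chebyshevNumerator n)
chebyshevNumerator≢0 n = m*n≢0 (n !) ((n / 30) !) {{n !≢0}} {{(n / 30) !≢0}}

chebyshevDenominator≢0 : ∀ n → NonZero (chebyshevDenominator n)
chebyshevDenominator≢0 n =
  m*n≢0 ((n / 2) ! * (n / 3) !) ((n / 5) !) {{(n / 2) !* (n / 3) !≢0}} {{(n / 5) !≢0}}

module ChebyshevFactorialValuations {p} (pp : Prime p) where
  private
    instance
      p≢0 : NonZero p
      p≢0 = prime⇒nonZero pp
    v = valuation p

    valuation-!*! : ∀ a b → v (a ! * b !) ≡ v (a !) + v (b !)
    valuation-!*! a b = valuation-* pp (a !) (b !) {{a !≢0}} {{b !≢0}}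

    valuation-!*!*! : ∀ a b c → v (a ! * b ! * c !) ≡ v (a !) + v (b !) + v (c !)
    valuation-!*!*! a b c = trans (valuation-* pp (a ! * b !) (c !) {{a !* b !≢0}} {{c !≢0}})
                                  (cong (_+ v (c !)) (valuation-!*! a b))

    valuation-[n/d]! : ∀ n d .{{_ : NonZero d}} → v ((n / d) !) ≡ n / p / d + v ((n / p / d) !)
    valuation-[n/d]! n d = trans (valuation-! pp (n / d)) (cong (λ m → m + v (m !)) (m/n/o≡m/o/n n d p))

  valuation-numerator : ∀ n → v (chebyshevNumerator n) ≡ numeratorSum (n / p) + v (chebyshevNumerator (n / p))
  valuation-numerator n = begin
    v (n ! * (n / 30) !)                        ≡⟨ valuation-!*! n (n / 30) ⟩
    v (n !) + v ((n / 30) !)                    ≡⟨ cong₂ _+_ (valuation-! pp n) (valuation-[n/d]! n 30) ⟩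
    (t + v (t !)) + (t / 30 + v ((t / 30) !))   ≡⟨ [m+n]+[o+p]≡[m+o]+[n+p] t (v (t !)) (t / 30) _ ⟩
    (t + t / 30) + (v (t !) + v ((t / 30) !))   ≡⟨ cong (numeratorSum t +_) (valuation-!*! t (t / 30)) ⟨
    numeratorSum t + v (chebyshevNumerator t)   ∎
    where
    open ≡-Reasoning
    t = n / p

  valuation-denominator : ∀ n →
    v (chebyshevDenominator n) ≡ denominatorSum (n / p) + v (chebyshevDenominator (n / p))
  valuation-denominator n = begin
    v ((n / 2) ! * (n / 3) ! * (n / 5) !)
      ≡⟨ valuation-!*!*! (n / 2) (n / 3) (n / 5) ⟩
    v ((n / 2) !) + v ((n / 3) !) + v ((n / 5) !)
      ≡⟨ cong₂ _+_ (cong₂ _+_ (valuation-[n/d]! n 2) (valuation-[n/d]! n 3)) (valuation-[n/d]! n 5) ⟩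
    (t / 2 + v ((t / 2) !)) + (t / 3 + v ((t / 3) !)) + (t / 5 + v ((t / 5) !))
      ≡⟨ rearrange (t / 2) (v ((t / 2) !)) (t / 3) (v ((t / 3) !)) (t / 5) (v ((t / 5) !)) ⟩
    denominatorSum t + (v ((t / 2) !) + v ((t / 3) !) + v ((t / 5) !))
      ≡⟨ cong (denominatorSum t +_) (valuation-!*!*! (t / 2) (t / 3) (t / 5)) ⟨
    denominatorSum t + v (chebyshevDenominator t)
      ∎
    where
    open ≡-Reasoning
    t = n / p
    rearrange : ∀ a b c d e f → (a + b) + (c + d) + (e + f) ≡ (a + c + e) + (b + d + f)
    rearrange = solve-∀

  valuation-denominator≤numerator : ∀ n → v (chebyshevDenominator n) ≤ v (chebyshevNumerator n)
  valuation-denominator≤numerator = /-rec p (nonTrivial⇒n>1 p {{prime⇒nonTrivial pp}})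
    (λ n → v (chebyshevDenominator n) ≤ v (chebyshevNumerator n)) ≤-refl
    (λ n ih → subst₂ _≤_ (sym (valuation-denominator (suc n))) (sym (valuation-numerator (suc n)))
                         (+-mono-≤ (proj₁ (chebyshevWeightBounds (suc n / p))) ih))

chebyshevDenominator∣Numerator : ∀ n → chebyshevDenominator n ∣ chebyshevNumerator n
chebyshevDenominator∣Numerator n =
  ∣-by-valuations _ _ {{chebyshevDenominator≢0 n}} {{chebyshevNumerator≢0 n}}
    (λ pp → ChebyshevFactorialValuations.valuation-denominator≤numerator pp n)

opaque
  chebyshev : ℕ → ℕ
  chebyshev n = (chebyshevNumerator n / chebyshevDenominator n) {{chebyshevDenominator≢0 n}}

  chebyshev*denominator≡numerator : ∀ n → chebyshev n * chebyshevDenominator n ≡ chebyshevNumerator n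
  chebyshev*denominator≡numerator n =
    m/n*n≡m {{chebyshevDenominator≢0 n}} (chebyshevDenominator∣Numerator n)

chebyshev[0] : chebyshev 0 ≡ 1
chebyshev[0] = trans (sym (*-identityʳ (chebyshev 0))) (chebyshev*denominator≡numerator 0)

chebyshev≢0 : ∀ n → NonZero (chebyshev n)
chebyshev≢0 n = m*n≢0⇒m≢0 (chebyshev n)
  {{subst NonZero (sym (chebyshev*denominator≡numerator n)) (chebyshevNumerator≢0 n)}}

module _ {p} (pp : Prime p) where
  open ChebyshevFactorialValuations pp
  private
    instance
      p≢0 : NonZero p
      p≢0 = prime⇒nonZero pp
    v = valuation p
    N = chebyshevNumerator
    D = chebyshevDenominator

    v[F]+v[D]≡v[N] : ∀ m → v (chebyshev m) + v (D m) ≡ v (N m)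
    v[F]+v[D]≡v[N] m =
      trans (sym (valuation-* pp (chebyshev m) (D m) {{chebyshev≢0 m}} {{chebyshevDenominator≢0 m}}))
            (cong v (chebyshev*denominator≡numerator m))

  valuation-chebyshev : ∀ n → v (chebyshev n) ≡ chebyshevWeight (n / p) + v (chebyshev (n / p))
  valuation-chebyshev n = +-cancelʳ-≡ (denominatorSum t + v (D t)) _ _ (begin
    v (chebyshev n) + (denominatorSum t + v (D t))
      ≡⟨ cong (v (chebyshev n) +_) (valuation-denominator n) ⟨
    v (chebyshev n) + v (D n)
      ≡⟨ v[F]+v[D]≡v[N] n ⟩
    v (N n)
      ≡⟨ valuation-numerator n ⟩
    numeratorSum t + v (N t)
      ≡⟨ cong₂ _+_ (sym (numeratorSum≡weight+denominatorSum t)) (v[F]+v[D]≡v[N] t) ⟨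
    (chebyshevWeight t + denominatorSum t) + (v (chebyshev t) + v (D t))
      ≡⟨ [m+n]+[o+p]≡[m+o]+[n+p] (chebyshevWeight t) (denominatorSum t) (v (chebyshev t)) (v (D t)) ⟩
    (chebyshevWeight t + v (chebyshev t)) + (denominatorSum t + v (D t))
      ∎)
    where
    open ≡-Reasoning
    t = n / p

⌊log⌋WithFuel : ℕ → (p : ℕ) .{{_ : NonZero p}} → ℕ → ℕ
⌊log⌋WithFuel zero    p n = 0
⌊log⌋WithFuel (suc f) p n = heaviside (n / p) + ⌊log⌋WithFuel f p (n / p)

⌊log⌋ : (p : ℕ) .{{_ : NonZero p}} → ℕ → ℕ
⌊log⌋ p n = ⌊log⌋WithFuel n p n

module _ {p} .{{_ : NonZero p}} (1<p : 1 < p) where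

  ⌊log⌋WithFuel[0] : ∀ f → ⌊log⌋WithFuel f p 0 ≡ 0
  ⌊log⌋WithFuel[0] zero    = refl
  ⌊log⌋WithFuel[0] (suc f) =
    trans (cong (λ t → heaviside t + ⌊log⌋WithFuel f p t) (0/n≡0 p)) (⌊log⌋WithFuel[0] f)

  ⌊log⌋WithFuel-irrelevant : ∀ f g n → n ≤ f → n ≤ g → ⌊log⌋WithFuel f p n ≡ ⌊log⌋WithFuel g p n
  ⌊log⌋WithFuel-irrelevant f g zero _ _ = trans (⌊log⌋WithFuel[0] f) (sym (⌊log⌋WithFuel[0] g))
  ⌊log⌋WithFuel-irrelevant (suc f) (suc g) n@(suc _) n≤1+f n≤1+g = cong (heaviside (n / p) +_)
    (⌊log⌋WithFuel-irrelevant f g (n / p) (<⇒≤pred (<-≤-trans n/p<n n≤1+f)) (<⇒≤pred (<-≤-trans n/p<n n≤1+g)))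
    where n/p<n = m/n<m n p 1<p

  ⌊log⌋-unfold : ∀ n → ⌊log⌋ p n ≡ heaviside (n / p) + ⌊log⌋ p (n / p)
  ⌊log⌋-unfold zero    = sym (cong (λ t → heaviside t + ⌊log⌋ p t) (0/n≡0 p))
  ⌊log⌋-unfold (suc n) = cong (heaviside (suc n / p) +_)
    (⌊log⌋WithFuel-irrelevant n (suc n / p) (suc n / p) (<⇒≤pred (m/n<m (suc n) p 1<p)) ≤-refl)

  ⌊log⌋-mono-≤ : ∀ {m n} → m ≤ n → ⌊log⌋ p m ≤ ⌊log⌋ p n
  ⌊log⌋-mono-≤ {m} {n} = /-rec p 1<p (λ n → ∀ {m} → m ≤ n → ⌊log⌋ p m ≤ ⌊log⌋ p n) base step n
    where
    base : ∀ {m} → m ≤ 0 → ⌊log⌋ p m ≤ ⌊log⌋ p 0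
    base z≤n = ≤-refl
    step : ∀ n → (∀ {m} → m ≤ suc n / p → ⌊log⌋ p m ≤ ⌊log⌋ p (suc n / p)) →
           ∀ {m} → m ≤ suc n → ⌊log⌋ p m ≤ ⌊log⌋ p (suc n)
    step n ih {m} m≤1+n = subst₂ _≤_ (sym (⌊log⌋-unfold m)) (sym (⌊log⌋-unfold (suc n)))
      (+-mono-≤ (heaviside-mono-≤ m/p≤[1+n]/p) (ih m/p≤[1+n]/p))
      where m/p≤[1+n]/p = /-monoˡ-≤ p m≤1+n

  ⌊log⌋[m*p] : ∀ m → ⌊log⌋ p (m * p) ≡ heaviside m + ⌊log⌋ p m
  ⌊log⌋[m*p] m = trans (⌊log⌋-unfold (m * p)) (cong (λ t → heaviside t + ⌊log⌋ p t) (m*n/n≡m m p))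

  ⌊log⌋<p : ∀ {n} → n < p → ⌊log⌋ p n ≡ 0
  ⌊log⌋<p {n} n<p = trans (⌊log⌋-unfold n) (cong (λ t → heaviside t + ⌊log⌋ p t) (m<n⇒m/n≡0 n<p))

  ⌊log⌋≥p : ∀ {n} → p ≤ n → 1 ≤ ⌊log⌋ p n
  ⌊log⌋≥p {n} p≤n = subst (1 ≤_) (sym (⌊log⌋-unfold n))
    (≤-trans (heaviside-mono-≤ (m≥n⇒m/n>0 p≤n)) (m≤m+n _ _))

  ⌊log⌋-gap : ∀ x y s → p ≤ x ⊎ y < p → y ≤ x * p → y < suc s * suc s →
              ⌊log⌋ p y ≤ ⌊log⌋ p x + ⌊log⌋ p s
  ⌊log⌋-gap x y s (inj₂ y<p) _ _ = subst (_≤ _) (sym (⌊log⌋<p y<p)) z≤n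
  ⌊log⌋-gap x y s (inj₁ p≤x) y≤x*p y<[1+s]² with p * p ≤? y
  ... | yes p²≤y = begin
    ⌊log⌋ p y                    ≤⟨ ⌊log⌋-mono-≤ y≤x*p ⟩
    ⌊log⌋ p (x * p)              ≡⟨ ⌊log⌋[m*p] x ⟩
    heaviside x + ⌊log⌋ p x      ≤⟨ +-monoˡ-≤ _ (≤-trans (heaviside≤1 x) (⌊log⌋≥p p≤s)) ⟩
    ⌊log⌋ p s + ⌊log⌋ p x        ≡⟨ +-comm (⌊log⌋ p s) _ ⟩
    ⌊log⌋ p x + ⌊log⌋ p s        ∎
    where
    open ≤-Reasoning
    p≤s : p ≤ s
    p≤s with p ≤? s
    ... | yes p≤s = p≤s
    ... | no  p≰s = contradiction (≤-trans (*-mono-≤ (≰⇒> p≰s) (≰⇒> p≰s)) p²≤y) (<⇒≱ y<[1+s]²)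
  ... | no p²≰y = begin
    ⌊log⌋ p y                           ≡⟨ ⌊log⌋-unfold y ⟩
    heaviside (y / p) + ⌊log⌋ p (y / p) ≡⟨ cong (heaviside (y / p) +_) (⌊log⌋<p (m<n*o⇒m/o<n (≰⇒> p²≰y))) ⟩
    heaviside (y / p) + 0               ≤⟨ +-monoˡ-≤ 0 (≤-trans (heaviside≤1 (y / p)) (⌊log⌋≥p p≤x)) ⟩
    ⌊log⌋ p x + 0                       ≤⟨ +-monoʳ-≤ (⌊log⌋ p x) z≤n ⟩
    ⌊log⌋ p x + ⌊log⌋ p s               ∎
    where open ≤-Reasoning

module _ {p} (pp : Prime p) where
  private
    instance
      p≢0 : NonZero p
      p≢0 = prime⇒nonZero pp
    1<p : 1 < p
    1<p = nonTrivial⇒n>1 p {{prime⇒nonTrivial pp}}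
    v = valuation p
    log = ⌊log⌋ p

  valuation-chebyshev≤⌊log⌋ : ∀ n → v (chebyshev n) ≤ log n
  valuation-chebyshev≤⌊log⌋ = /-rec p 1<p (λ n → v (chebyshev n) ≤ log n)
    (≤-reflexive (trans (cong v chebyshev[0]) (valuation-1 pp)))
    (λ n ih → subst₂ _≤_ (sym (valuation-chebyshev pp (suc n))) (sym (⌊log⌋-unfold 1<p (suc n)))
                         (+-mono-≤ (chebyshevWeight≤heaviside (suc n / p)) ih))

  ⌊log⌋≤valuation-chebyshev+⌊log⌋[/6] : ∀ n → log n ≤ v (chebyshev n) + log (n / 6)
  ⌊log⌋≤valuation-chebyshev+⌊log⌋[/6] = /-rec p 1<p (λ n → log n ≤ v (chebyshev n) + log (n / 6)) z≤n step
    where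
    step : ∀ n → log (suc n / p) ≤ v (chebyshev (suc n / p)) + log (suc n / p / 6) →
           log (suc n) ≤ v (chebyshev (suc n)) + log (suc n / 6)
    step n ih = begin
      log (suc n)
        ≡⟨ ⌊log⌋-unfold 1<p (suc n) ⟩
      heaviside t + log t
        ≤⟨ +-mono-≤ (heaviside≤weight+heaviside[/6] t) ih ⟩
      (chebyshevWeight t + heaviside (t / 6)) + (v (chebyshev t) + log (t / 6))
        ≡⟨ [m+n]+[o+p]≡[m+o]+[n+p] (chebyshevWeight t) (heaviside (t / 6)) (v (chebyshev t)) (log (t / 6)) ⟩
      (chebyshevWeight t + v (chebyshev t)) + (heaviside (t / 6) + log (t / 6))
        ≡⟨ cong₂ _+_ (valuation-chebyshev pp (suc n)) log[[1+n]/6] ⟨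
      v (chebyshev (suc n)) + log (suc n / 6)
        ∎
      where
      open ≤-Reasoning
      t = suc n / p
      log[[1+n]/6] : log (suc n / 6) ≡ heaviside (t / 6) + log (t / 6)
      log[[1+n]/6] = trans (⌊log⌋-unfold 1<p (suc n / 6))
        (cong (λ m → heaviside m + log m) (m/n/o≡m/o/n (suc n) 6 p))

  ⌊log⌋≤valuation-! : ∀ n → log n ≤ v (n !)
  ⌊log⌋≤valuation-! = /-rec p 1<p (λ n → log n ≤ v (n !)) z≤n
    (λ n ih → subst₂ _≤_ (sym (⌊log⌋-unfold 1<p (suc n))) (sym (valuation-! pp (suc n)))
                         (+-mono-≤ (heaviside≤id (suc n / p)) ih))

Linear : Set
Linear = ℕ × ℕ

⟦_⟧ : Linear → ℕ → ℕ
⟦ a , b ⟧ m = m * a + b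

⟦_⟧* : List Linear → ℕ → ℕ
⟦ ls ⟧* m = product (map (λ l → ⟦ l ⟧ m) ls)

leadingCoefficient : List Linear → ℕ
leadingCoefficient ls = product (map proj₁ ls)

⟦⟧*-++ : ∀ xs ys m → ⟦ xs ++ ys ⟧* m ≡ ⟦ xs ⟧* m * ⟦ ys ⟧* m
⟦⟧*-++ xs ys m =
  trans (cong product (map-++ (λ l → ⟦ l ⟧ m) xs ys)) (product-++ (map (λ l → ⟦ l ⟧ m) xs) _)

⟦⟧*-↭ : ∀ {xs ys} → xs ↭ ys → ∀ m → ⟦ xs ⟧* m ≡ ⟦ ys ⟧* m
⟦⟧*-↭ xs↭ys m = product-↭ (map⁺ (λ l → ⟦ l ⟧ m) xs↭ys)

⟦⟧*≢0 : ∀ {ls} → All (λ l → 0 < proj₂ l) ls → ∀ m → NonZero (⟦ ls ⟧* m)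
⟦⟧*≢0 []                                  m = _
⟦⟧*≢0 {(a , suc b) ∷ ls} (_ ∷ constants>0) m =
  m*n≢0 (m * a + suc b) (⟦ ls ⟧* m) {{≢-nonZero (m+1+n≢0 (m * a))}} {{⟦⟧*≢0 constants>0 m}}

risingFactors : ℕ → ℕ → List Linear
risingFactors a zero    = []
risingFactors a (suc k) = (a , suc k) ∷ risingFactors a k

[m*a+k]! : ∀ m a k → (m * a + k) ! ≡ ⟦ risingFactors a k ⟧* m * (m * a) !
[m*a+k]! m a zero    = trans (cong _! (+-identityʳ (m * a))) (sym (*-identityˡ ((m * a) !)))
[m*a+k]! m a (suc k) = begin
  (m * a + suc k) !                                        ≡⟨ cong _! (+-suc (m * a) k) ⟩
  suc (m * a + k) * (m * a + k) !                          ≡⟨ cong₂ _*_ (+-suc (m * a) k) (sym ([m*a+k]! m a k)) ⟨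
  (m * a + suc k) * (⟦ risingFactors a k ⟧* m * (m * a) !) ≡⟨ *-assoc (m * a + suc k) _ _ ⟨
  ⟦ risingFactors a (suc k) ⟧* m * (m * a) !               ∎
  where open ≡-Reasoning

RatioPair : Set
RatioPair = Linear × Linear

numerators denominators : List RatioPair → List Linear
numerators   = map proj₁
denominators = map proj₂

NondecreasingRatio : RatioPair → Set
NondecreasingRatio ((a , b) , (c , d)) = b * c ≤ a * d

module _ {a b c d : ℕ} (bc≤ad : b * c ≤ a * d) where

  ratio-mono : ∀ m k → (m * a + b) * ((k + m) * c + d) ≤ ((k + m) * a + b) * (m * c + d)
  ratio-mono m k = +-cancelʳ-≤ (k * (b * c)) _ _ (begin
    (m * a + b) * ((k + m) * c + d) + k * (b * c) ≤⟨ +-monoʳ-≤ _ (*-monoʳ-≤ k bc≤ad) ⟩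
    (m * a + b) * ((k + m) * c + d) + k * (a * d) ≡⟨ expand a b c d m k ⟩
    ((k + m) * a + b) * (m * c + d) + k * (b * c) ∎)
    where
    open ≤-Reasoning
    expand : ∀ a b c d m k → (m * a + b) * ((k + m) * c + d) + k * (a * d) ≡
                             ((k + m) * a + b) * (m * c + d) + k * (b * c)
    expand = solve-∀

  ratio-bounded : ∀ m → (m * a + b) * c ≤ a * (m * c + d)
  ratio-bounded m = subst₂ _≤_ (sym (lhs a b c m)) (sym (rhs a c d m)) (+-monoʳ-≤ (m * a * c) bc≤ad)
    where
    lhs : ∀ a b c m → (m * a + b) * c ≡ m * a * c + b * c
    lhs = solve-∀
    rhs : ∀ a c d m → a * (m * c + d) ≡ m * a * c + a * d
    rhs = solve-∀

⟦⟧*-ratio-mono : ∀ {ps} → All NondecreasingRatio ps → ∀ m k →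
  ⟦ numerators ps ⟧* m * ⟦ denominators ps ⟧* (k + m) ≤ ⟦ numerators ps ⟧* (k + m) * ⟦ denominators ps ⟧* m
⟦⟧*-ratio-mono [] m k = ≤-refl
⟦⟧*-ratio-mono {((a , b) , (c , d)) ∷ ps} (nondecreasing ∷ nondecreasings) m k = begin
  ((m * a + b) * N m) * (((k + m) * c + d) * D (k + m))
    ≡⟨ [m*n]*[o*p]≡[m*o]*[n*p] (m * a + b) (N m) ((k + m) * c + d) (D (k + m)) ⟩
  ((m * a + b) * ((k + m) * c + d)) * (N m * D (k + m))
    ≤⟨ *-mono-≤ (ratio-mono nondecreasing m k) (⟦⟧*-ratio-mono nondecreasings m k) ⟩
  (((k + m) * a + b) * (m * c + d)) * (N (k + m) * D m)
    ≡⟨ [m*n]*[o*p]≡[m*o]*[n*p] ((k + m) * a + b) (m * c + d) (N (k + m)) (D m) ⟩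
  (((k + m) * a + b) * N (k + m)) * ((m * c + d) * D m)
    ∎
  where
  open ≤-Reasoning
  N = ⟦ numerators ps ⟧*
  D = ⟦ denominators ps ⟧*

⟦⟧*-ratio-bounded : ∀ {ps} → All NondecreasingRatio ps → ∀ m →
  ⟦ numerators ps ⟧* m * leadingCoefficient (denominators ps) ≤
  leadingCoefficient (numerators ps) * ⟦ denominators ps ⟧* m
⟦⟧*-ratio-bounded [] m = ≤-refl
⟦⟧*-ratio-bounded {((a , b) , (c , d)) ∷ ps} (nondecreasing ∷ nondecreasings) m = begin
  ((m * a + b) * N m) * (c * C)  ≡⟨ [m*n]*[o*p]≡[m*o]*[n*p] (m * a + b) (N m) c C ⟩
  ((m * a + b) * c) * (N m * C)  ≤⟨ *-mono-≤ (ratio-bounded nondecreasing m) (⟦⟧*-ratio-bounded nondecreasings m) ⟩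
  (a * (m * c + d)) * (A * D m)  ≡⟨ [m*n]*[o*p]≡[m*o]*[n*p] a (m * c + d) A (D m) ⟩
  (a * A) * ((m * c + d) * D m)  ∎
  where
  open ≤-Reasoning
  N = ⟦ numerators ps ⟧*
  D = ⟦ denominators ps ⟧*
  A = leadingCoefficient (numerators ps)
  C = leadingCoefficient (denominators ps)

↭-by-sort : ∀ {xs ys : List Linear} → sort xs ≡ sort ys → xs ↭ ys
↭-by-sort {xs} {ys} sorted≡ = ↭-trans (↭-sym (sort-↭ xs)) (↭-trans (↭-reflexive sorted≡) (sort-↭ ys))

-- Growth of Chebyshev's quotient

[m*30+30]/d : ∀ m {d k} .{{_ : NonZero d}} → k * d ≡ 30 → (m * 30 + 30) / d ≡ m * k + k
[m*30+30]/d m {d} {k} k*d≡30 =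
  trans (/-congˡ (+-comm (m * 30) 30)) (trans ([m*30]/d (suc m) k*d≡30) (+-comm k (m * k)))

numeratorBlock denominatorBlock : List Linear
numeratorBlock   = risingFactors 30 30 ++ risingFactors 1 1
denominatorBlock = risingFactors 15 15 ++ risingFactors 10 10 ++ risingFactors 6 6

chebyshevNumerator-step : ∀ m →
  chebyshevNumerator (m * 30 + 30) ≡ ⟦ numeratorBlock ⟧* m * chebyshevNumerator (m * 30)
chebyshevNumerator-step m = begin
  (m * 30 + 30) ! * ((m * 30 + 30) / 30) !
    ≡⟨ cong (λ t → (m * 30 + 30) ! * t !) ([m*30+30]/d m {k = 1} refl) ⟩
  (m * 30 + 30) ! * (m * 1 + 1) !
    ≡⟨ cong₂ _*_ ([m*a+k]! m 30 30) ([m*a+k]! m 1 1) ⟩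
  (R₃₀ * (m * 30) !) * (R₁ * (m * 1) !)
    ≡⟨ [m*n]*[o*p]≡[m*o]*[n*p] R₃₀ _ R₁ _ ⟩
  (R₃₀ * R₁) * ((m * 30) ! * (m * 1) !)
    ≡⟨ cong₂ _*_ (⟦⟧*-++ (risingFactors 30 30) (risingFactors 1 1) m)
                 (cong (λ t → (m * 30) ! * t !) ([m*30]/d m {k = 1} refl)) ⟨
  ⟦ numeratorBlock ⟧* m * chebyshevNumerator (m * 30)
    ∎
  where
  open ≡-Reasoning
  R₃₀ = ⟦ risingFactors 30 30 ⟧* m
  R₁  = ⟦ risingFactors 1 1 ⟧* m

chebyshevDenominator-step : ∀ m →
  chebyshevDenominator (m * 30 + 30) ≡ ⟦ denominatorBlock ⟧* m * chebyshevDenominator (m * 30)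
chebyshevDenominator-step m = begin
  (x / 2) ! * (x / 3) ! * (x / 5) !
    ≡⟨ cong₂ _*_ (cong₂ _*_ (cong _! ([m*30+30]/d m {k = 15} refl)) (cong _! ([m*30+30]/d m {k = 10} refl)))
                 (cong _! ([m*30+30]/d m {k = 6} refl)) ⟩
  (m * 15 + 15) ! * (m * 10 + 10) ! * (m * 6 + 6) !
    ≡⟨ cong₂ _*_ (cong₂ _*_ ([m*a+k]! m 15 15) ([m*a+k]! m 10 10)) ([m*a+k]! m 6 6) ⟩
  (R₁₅ * (m * 15) !) * (R₁₀ * (m * 10) !) * (R₆ * (m * 6) !)
    ≡⟨ rearrange R₁₅ ((m * 15) !) R₁₀ ((m * 10) !) R₆ ((m * 6) !) ⟩
  (R₁₅ * (R₁₀ * R₆)) * ((m * 15) ! * (m * 10) ! * (m * 6) !)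
    ≡⟨ cong₂ _*_ blocks (cong₂ _*_ (cong₂ _*_ (cong _! ([m*30]/d m {k = 15} refl)) (cong _! ([m*30]/d m {k = 10} refl)))
                                   (cong _! ([m*30]/d m {k = 6} refl))) ⟨
  ⟦ denominatorBlock ⟧* m * chebyshevDenominator (m * 30)
    ∎
  where
  open ≡-Reasoning
  x = m * 30 + 30
  R₁₅ = ⟦ risingFactors 15 15 ⟧* m
  R₁₀ = ⟦ risingFactors 10 10 ⟧* m
  R₆  = ⟦ risingFactors 6 6 ⟧* m
  blocks : ⟦ denominatorBlock ⟧* m ≡ R₁₅ * (R₁₀ * R₆)
  blocks = trans (⟦⟧*-++ (risingFactors 15 15) (risingFactors 10 10 ++ risingFactors 6 6) m)
                 (cong (R₁₅ *_) (⟦⟧*-++ (risingFactors 10 10) (risingFactors 6 6) m))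
  rearrange : ∀ a b c d e f → (a * b) * (c * d) * (e * f) ≡ (a * (c * e)) * (b * d * f)
  rearrange = solve-∀

chebyshev-step : ∀ m →
  chebyshev (m * 30 + 30) * ⟦ denominatorBlock ⟧* m ≡ ⟦ numeratorBlock ⟧* m * chebyshev (m * 30)
chebyshev-step m = *-cancelʳ-≡ _ _ (D (m * 30)) {{chebyshevDenominator≢0 (m * 30)}} (begin
  F (m * 30 + 30) * B m * D (m * 30)      ≡⟨ *-assoc (F (m * 30 + 30)) (B m) (D (m * 30)) ⟩
  F (m * 30 + 30) * (B m * D (m * 30))    ≡⟨ cong (F (m * 30 + 30) *_) (chebyshevDenominator-step m) ⟨
  F (m * 30 + 30) * D (m * 30 + 30)       ≡⟨ chebyshev*denominator≡numerator (m * 30 + 30) ⟩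
  N (m * 30 + 30)                         ≡⟨ chebyshevNumerator-step m ⟩
  A m * N (m * 30)                        ≡⟨ cong (A m *_) (chebyshev*denominator≡numerator (m * 30)) ⟨
  A m * (F (m * 30) * D (m * 30))         ≡⟨ *-assoc (A m) (F (m * 30)) (D (m * 30)) ⟨
  A m * F (m * 30) * D (m * 30)           ∎)
  where
  open ≡-Reasoning
  F = chebyshev
  N = chebyshevNumerator
  D = chebyshevDenominator
  A = ⟦ numeratorBlock ⟧*
  B = ⟦ denominatorBlock ⟧*

-- Each factor of ⟦ numeratorBlock ⟧* is matched with a factor of ⟦ denominatorBlock ⟧* so that
-- every quotient of the two is nondecreasing in m.
pairing : List RatioPair
pairing =
  ((30 , 30) , (10 , 10)) ∷ ((30 , 29) , (6 , 6))   ∷ ((30 , 28) , (15 , 14)) ∷ ((30 , 27) , (10 , 9))  ∷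
  ((30 , 26) , (15 , 13)) ∷ ((30 , 25) , (6 , 5))   ∷ ((30 , 24) , (15 , 12)) ∷ ((30 , 23) , (10 , 8))  ∷
  ((30 , 22) , (15 , 11)) ∷ ((30 , 21) , (10 , 7))  ∷ ((30 , 20) , (15 , 10)) ∷ ((30 , 19) , (6 , 4))   ∷
  ((30 , 18) , (15 , 9))  ∷ ((30 , 17) , (10 , 6))  ∷ ((30 , 16) , (15 , 8))  ∷ ((30 , 15) , (10 , 5))  ∷
  ((30 , 14) , (15 , 7))  ∷ ((30 , 13) , (6 , 3))   ∷ ((30 , 12) , (15 , 6))  ∷ ((30 , 11) , (10 , 4))  ∷
  ((30 , 10) , (15 , 5))  ∷ ((30 , 9)  , (10 , 3))  ∷ ((30 , 8)  , (15 , 4))  ∷ ((30 , 7)  , (6 , 2))   ∷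
  ((30 , 6)  , (15 , 3))  ∷ ((30 , 5)  , (10 , 2))  ∷ ((30 , 4)  , (15 , 2))  ∷ ((30 , 3)  , (10 , 1))  ∷
  ((30 , 2)  , (15 , 1))  ∷ ((30 , 1)  , (6 , 1))   ∷ ((1 , 1)   , (15 , 15)) ∷ []

pairing-numerators : numerators pairing ≡ numeratorBlock
pairing-numerators = refl

pairing-denominators : denominators pairing ↭ denominatorBlock
pairing-denominators = ↭-by-sort refl

pairing-nondecreasing : All NondecreasingRatio pairing
pairing-nondecreasing = from-yes (all? (λ ((a , b) , (c , d)) → b * c ≤? a * d) pairing)

pairing-denominators≢0 : ∀ m → NonZero (⟦ denominators pairing ⟧* m)
pairing-denominators≢0 = ⟦⟧*≢0 (from-yes (all? (λ l → 0 <? proj₂ l) (denominators pairing)))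

pairing-step : ∀ m →
  chebyshev (m * 30 + 30) * ⟦ denominators pairing ⟧* m ≡ ⟦ numerators pairing ⟧* m * chebyshev (m * 30)
pairing-step m = begin
  F (m * 30 + 30) * ⟦ denominators pairing ⟧* m ≡⟨ cong (F (m * 30 + 30) *_) (⟦⟧*-↭ pairing-denominators m) ⟩
  F (m * 30 + 30) * ⟦ denominatorBlock ⟧* m     ≡⟨ chebyshev-step m ⟩
  ⟦ numeratorBlock ⟧* m * F (m * 30)            ≡⟨ cong (λ ls → ⟦ ls ⟧* m * F (m * 30)) pairing-numerators ⟨
  ⟦ numerators pairing ⟧* m * F (m * 30)        ∎
  where
  open ≡-Reasoning
  F = chebyshev

-- U = 30³⁰ / (15¹⁵ 10¹⁰ 6⁶)
opaque
  U : ℕ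
  U = 2 ^ 14 * 3 ^ 9 * 5 ^ 5

  leadingCoefficient-pairing : leadingCoefficient (numerators pairing) ≡ U * leadingCoefficient (denominators pairing)
  leadingCoefficient-pairing = refl

chebyshev-step-upper : ∀ m → chebyshev (m * 30 + 30) ≤ U * chebyshev (m * 30)
chebyshev-step-upper m = *-cancelʳ-≤ _ _ (B m * C) {{m*n≢0 (B m) C {{pairing-denominators≢0 m}}}} (begin
  F (m * 30 + 30) * (B m * C)   ≡⟨ *-assoc (F (m * 30 + 30)) (B m) C ⟨
  F (m * 30 + 30) * B m * C     ≡⟨ cong (_* C) (pairing-step m) ⟩
  A m * F (m * 30) * C          ≡⟨ m*n*o≡m*o*n (A m) (F (m * 30)) C ⟩
  A m * C * F (m * 30)          ≤⟨ *-monoˡ-≤ (F (m * 30)) (⟦⟧*-ratio-bounded pairing-nondecreasing m) ⟩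
  Aₗ * B m * F (m * 30)         ≡⟨ cong (λ a → a * B m * F (m * 30)) leadingCoefficient-pairing ⟩
  U * C * B m * F (m * 30)      ≡⟨ rearrange U C (B m) (F (m * 30)) ⟩
  U * F (m * 30) * (B m * C)    ∎)
  where
  open ≤-Reasoning
  F = chebyshev
  A = ⟦ numerators pairing ⟧*
  B = ⟦ denominators pairing ⟧*
  Aₗ = leadingCoefficient (numerators pairing)
  C = leadingCoefficient (denominators pairing)
  rearrange : ∀ u c b f → u * c * b * f ≡ u * f * (b * c)
  rearrange = solve-∀

opaque
  ρ : ℕ
  ρ = 900000000000

  ρ≤pairingRatio[5] : ρ * ⟦ denominators pairing ⟧* 5 ≤ ⟦ numerators pairing ⟧* 5
  ρ≤pairingRatio[5] = from-yes (ρ * ⟦ denominators pairing ⟧* 5 ≤? ⟦ numerators pairing ⟧* 5)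

chebyshev-step-lower : ∀ k → ρ * chebyshev ((k + 5) * 30) ≤ chebyshev ((k + 5) * 30 + 30)
chebyshev-step-lower k = *-cancelʳ-≤ _ _ (B m * B 5) {{B[m]*B[5]≢0}} (begin
  ρ * F (m * 30) * (B m * B 5)  ≡⟨ rearrange ρ (F (m * 30)) (B m) (B 5) ⟩
  ρ * B 5 * (B m * F (m * 30))  ≤⟨ *-monoˡ-≤ _ ρ≤pairingRatio[5] ⟩
  A 5 * (B m * F (m * 30))      ≡⟨ *-assoc (A 5) (B m) (F (m * 30)) ⟨
  A 5 * B m * F (m * 30)        ≤⟨ *-monoˡ-≤ (F (m * 30)) (⟦⟧*-ratio-mono pairing-nondecreasing 5 k) ⟩
  A m * B 5 * F (m * 30)        ≡⟨ m*n*o≡m*o*n (A m) (B 5) (F (m * 30)) ⟩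
  A m * F (m * 30) * B 5        ≡⟨ cong (_* B 5) (pairing-step m) ⟨
  F (m * 30 + 30) * B m * B 5   ≡⟨ *-assoc (F (m * 30 + 30)) (B m) (B 5) ⟩
  F (m * 30 + 30) * (B m * B 5) ∎)
  where
  open ≤-Reasoning
  m = k + 5
  F = chebyshev
  A = ⟦ numerators pairing ⟧*
  B = ⟦ denominators pairing ⟧*
  B[m]*B[5]≢0 = m*n≢0 (B m) (B 5) {{pairing-denominators≢0 m}} {{pairing-denominators≢0 5}}
  rearrange : ∀ r f b c → r * f * (b * c) ≡ r * c * (b * f)
  rearrange = solve-∀

chebyshev[30n]≤U^n : ∀ n → chebyshev (n * 30) ≤ U ^ n
chebyshev[30n]≤U^n zero    = ≤-reflexive chebyshev[0]
chebyshev[30n]≤U^n (suc n) = begin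
  chebyshev (suc n * 30)       ≡⟨ cong chebyshev (+-comm 30 (n * 30)) ⟩
  chebyshev (n * 30 + 30)      ≤⟨ chebyshev-step-upper n ⟩
  U * chebyshev (n * 30)       ≤⟨ *-monoʳ-≤ U (chebyshev[30n]≤U^n n) ⟩
  U * U ^ n                    ∎
  where open ≤-Reasoning

ρ^k≤chebyshev[30[k+5]] : ∀ k → ρ ^ k ≤ chebyshev ((k + 5) * 30)
ρ^k≤chebyshev[30[k+5]] zero    = >-nonZero⁻¹ _ {{chebyshev≢0 150}}
ρ^k≤chebyshev[30[k+5]] (suc k) = begin
  ρ * ρ ^ k                          ≤⟨ *-monoʳ-≤ ρ (ρ^k≤chebyshev[30[k+5]] k) ⟩
  ρ * chebyshev ((k + 5) * 30)       ≤⟨ chebyshev-step-lower k ⟩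
  chebyshev ((k + 5) * 30 + 30)      ≡⟨ cong chebyshev (+-comm ((k + 5) * 30) 30) ⟩
  chebyshev ((suc k + 5) * 30)       ∎
  where open ≤-Reasoning

-- A multiple of lcm(1, …, 30n)

⌈_/6⌉ : ℕ → ℕ
⌈ n /6⌉ = (n + 5) / 6

⌈n/6⌉<n : ∀ {n} → 2 ≤ n → ⌈ n /6⌉ < n
⌈n/6⌉<n {n} 1<n = m<n*o⇒m/o<n {o = 6} (subst (n + 5 <_) (sym (*-suc n 5)) (+-monoʳ-< n (*-monoˡ-< 5 1<n)))

n≤⌈n/6⌉*6 : ∀ n → n ≤ ⌈ n /6⌉ * 6
n≤⌈n/6⌉*6 n = +-cancelʳ-≤ 5 n (⌈ n /6⌉ * 6) (begin
  n + 5                         ≡⟨ m≡m%n+[m/n]*n (n + 5) 6 ⟩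
  (n + 5) % 6 + ⌈ n /6⌉ * 6     ≤⟨ +-monoˡ-≤ _ (<⇒≤pred (m%n<n (n + 5) 6)) ⟩
  5 + ⌈ n /6⌉ * 6               ≡⟨ +-comm 5 _ ⟩
  ⌈ n /6⌉ * 6 + 5               ∎)
  where open ≤-Reasoning

⌈[n+6]/6⌉ : ∀ n → ⌈ n + 6 /6⌉ ≡ suc ⌈ n /6⌉
⌈[n+6]/6⌉ n =
  trans (/-congˡ (+-right-comm n 6 5)) (trans (+-distrib-/-∣ʳ (n + 5) (divides 1 refl)) (+-comm ⌈ n /6⌉ 1))
  where
  +-right-comm : ∀ a b c → a + b + c ≡ a + c + b
  +-right-comm = solve-∀

descendingProductWithFuel : ℕ → (ℕ → ℕ) → ℕ → ℕ
descendingProductWithFuel _       h 0               = 1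
descendingProductWithFuel _       h 1               = 30 !
descendingProductWithFuel zero    h (suc (suc _))   = 1
descendingProductWithFuel (suc f) h n@(suc (suc _)) = h n * descendingProductWithFuel f h ⌈ n /6⌉

descendingProduct : (ℕ → ℕ) → ℕ → ℕ
descendingProduct h n = descendingProductWithFuel n h n

module _ (h : ℕ → ℕ) where

  descendingProductWithFuel-irrelevant : ∀ f g n → n ≤ f → n ≤ g →
    descendingProductWithFuel f h n ≡ descendingProductWithFuel g h n
  descendingProductWithFuel-irrelevant f       g       0               _ _ = refl
  descendingProductWithFuel-irrelevant f       g       1               _ _ = refl
  descendingProductWithFuel-irrelevant (suc f) (suc g) n@(suc (suc _)) n≤1+f n≤1+g = cong (h n *_)
    (descendingProductWithFuel-irrelevant f g ⌈ n /6⌉ (<⇒≤pred (<-≤-trans c<n n≤1+f)) (<⇒≤pred (<-≤-trans c<n n≤1+g)))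
    where c<n = ⌈n/6⌉<n {n} (s≤s (s≤s z≤n))

  descendingProduct-unfold : ∀ {n} → 2 ≤ n → descendingProduct h n ≡ h n * descendingProduct h ⌈ n /6⌉
  descendingProduct-unfold {n@(suc (suc k))} 2≤n@(s≤s (s≤s _)) = cong (h n *_)
    (descendingProductWithFuel-irrelevant (suc k) ⌈ n /6⌉ ⌈ n /6⌉ (<⇒≤pred (⌈n/6⌉<n 2≤n)) ≤-refl)

  descendingProduct≢0 : (∀ n → NonZero (h n)) → ∀ n → NonZero (descendingProduct h n)
  descendingProduct≢0 h≢0 n = go n n
    where
    go : ∀ f n → NonZero (descendingProductWithFuel f h n)
    go _       0               = _
    go _       1               = 30 !≢0
    go zero    (suc (suc _))   = _
    go (suc f) n@(suc (suc _)) = m*n≢0 (h n) _ {{h≢0 n}} {{go f ⌈ n /6⌉}}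

descendingProduct-mono-≤ : ∀ {g h} → (∀ n → g n ≤ h n) → ∀ n → descendingProduct g n ≤ descendingProduct h n
descendingProduct-mono-≤ {g} {h} g≤h n = go n n
  where
  go : ∀ f n → descendingProductWithFuel f g n ≤ descendingProductWithFuel f h n
  go _       0               = ≤-refl
  go _       1               = ≤-refl
  go zero    (suc (suc _))   = ≤-refl
  go (suc f) n@(suc (suc _)) = *-mono-≤ (g≤h n) (go f ⌈ n /6⌉)

lcmMultiple : ℕ → ℕ
lcmMultiple = descendingProduct (λ m → chebyshev (m * 30))

lcmMultiple≢0 : ∀ n → NonZero (lcmMultiple n)
lcmMultiple≢0 = descendingProduct≢0 _ (λ m → chebyshev≢0 (m * 30))

lcmMultiple-unfold : ∀ {n} → 2 ≤ n → lcmMultiple n ≡ chebyshev (n * 30) * lcmMultiple ⌈ n /6⌉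
lcmMultiple-unfold = descendingProduct-unfold (λ m → chebyshev (m * 30))

module _ {p} (pp : Prime p) where
  private
    instance
      p≢0 : NonZero p
      p≢0 = prime⇒nonZero pp
    v = valuation p
    log = ⌊log⌋ p

  ⌊log⌋≤valuation-lcmMultiple : ∀ n → log (n * 30) ≤ v (lcmMultiple n)
  ⌊log⌋≤valuation-lcmMultiple = <-rec _ go
    where
    go : ∀ n → (∀ {m} → m < n → log (m * 30) ≤ v (lcmMultiple m)) → log (n * 30) ≤ v (lcmMultiple n)
    go 0               _  = z≤n
    go 1               _  = ⌊log⌋≤valuation-! pp 30
    go n@(suc (suc _)) ih = begin
      log (n * 30)                                 ≤⟨ ⌊log⌋≤valuation-chebyshev+⌊log⌋[/6] pp (n * 30) ⟩
      v (chebyshev (n * 30)) + log (n * 30 / 6)    ≤⟨ +-monoʳ-≤ _ (⌊log⌋-mono-≤ 1<p 30n/6≤30⌈n/6⌉) ⟩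
      v (chebyshev (n * 30)) + log (c * 30)        ≤⟨ +-monoʳ-≤ _ (ih (⌈n/6⌉<n 2≤n)) ⟩
      v (chebyshev (n * 30)) + v (lcmMultiple c)
        ≡⟨ valuation-* pp (chebyshev (n * 30)) (lcmMultiple c) {{chebyshev≢0 (n * 30)}} {{lcmMultiple≢0 c}} ⟨
      v (chebyshev (n * 30) * lcmMultiple c)       ≡⟨ cong v (lcmMultiple-unfold 2≤n) ⟨
      v (lcmMultiple n)                            ∎
      where
      open ≤-Reasoning
      1<p = nonTrivial⇒n>1 p {{prime⇒nonTrivial pp}}
      2≤n = s≤s (s≤s z≤n)
      c = ⌈ n /6⌉
      30n/6≤30⌈n/6⌉ : n * 30 / 6 ≤ c * 30
      30n/6≤30⌈n/6⌉ = begin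
        n * 30 / 6      ≡⟨ /-congˡ {o = 6} (sym (*-assoc n 5 6)) ⟩
        n * 5 * 6 / 6   ≡⟨ m*n/n≡m (n * 5) 6 ⟩
        n * 5           ≤⟨ *-monoˡ-≤ 5 (n≤⌈n/6⌉*6 n) ⟩
        c * 6 * 5       ≡⟨ *-assoc c 6 5 ⟩
        c * 30          ∎

-- Since U⁶ V ≤ V⁶, the bound U^n V^⌈n/6⌉ ≤ V^n propagates from 24 ≤ n < 30 upwards; K absorbs n < 24.
opaque
  V K : ℕ
  V = 2 ^ 51
  K = 2 ^ 110

opaque
  unfolding U V K

  descendingProduct[U^]≤K*V^n : ∀ {n} → n < 24 → descendingProduct (U ^_) n ≤ K * V ^ n
  descendingProduct[U^]≤K*V^n = from-yes (allUpTo? (λ n → descendingProduct (U ^_) n ≤? K * V ^ n) 24)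

  U^n*V^⌈n/6⌉≤V^n[24≤n<30] : ∀ {r} → r < 6 → U ^ (r + 24) * V ^ ⌈ r + 24 /6⌉ ≤ V ^ (r + 24)
  U^n*V^⌈n/6⌉≤V^n[24≤n<30] = from-yes (allUpTo? (λ r → U ^ (r + 24) * V ^ ⌈ r + 24 /6⌉ ≤? V ^ (r + 24)) 6)

  U^6*V≤V^6 : U ^ 6 * V ≤ V ^ 6
  U^6*V≤V^6 = from-yes (U ^ 6 * V ≤? V ^ 6)

U^n*V^⌈n/6⌉≤V^n-step : ∀ m → U ^ m * V ^ ⌈ m /6⌉ ≤ V ^ m → U ^ (m + 6) * V ^ ⌈ m + 6 /6⌉ ≤ V ^ (m + 6)
U^n*V^⌈n/6⌉≤V^n-step m hyp = begin
  U ^ (m + 6) * V ^ ⌈ m + 6 /6⌉         ≡⟨ cong₂ _*_ (^-distribˡ-+-* U m 6) (cong (V ^_) (⌈[n+6]/6⌉ m)) ⟩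
  U ^ m * U ^ 6 * (V * V ^ ⌈ m /6⌉)     ≡⟨ rearrange (U ^ m) (U ^ 6) V (V ^ ⌈ m /6⌉) ⟩
  (U ^ m * V ^ ⌈ m /6⌉) * (U ^ 6 * V)   ≤⟨ *-mono-≤ hyp U^6*V≤V^6 ⟩
  V ^ m * V ^ 6                         ≡⟨ ^-distribˡ-+-* V m 6 ⟨
  V ^ (m + 6)                           ∎
  where
  open ≤-Reasoning
  rearrange : ∀ a b c d → a * b * (c * d) ≡ (a * d) * (b * c)
  rearrange = solve-∀

U^n*V^⌈n/6⌉≤V^n : ∀ {n} → 24 ≤ n → U ^ n * V ^ ⌈ n /6⌉ ≤ V ^ n
U^n*V^⌈n/6⌉≤V^n {n} = <-rec (λ n → 24 ≤ n → P n) go n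
  where
  P = λ n → U ^ n * V ^ ⌈ n /6⌉ ≤ V ^ n
  go : ∀ n → (∀ {m} → m < n → 24 ≤ m → P m) → 24 ≤ n → P n
  go n ih 24≤n with n <? 30
  ... | yes n<30 = subst P (m∸n+n≡m 24≤n)
    (U^n*V^⌈n/6⌉≤V^n[24≤n<30] (+-cancelʳ-< 24 (n ∸ 24) 6 (subst (_< 30) (sym (m∸n+n≡m 24≤n)) n<30)))
  ... | no  n≮30 = subst P (m∸n+n≡m 6≤n) (U^n*V^⌈n/6⌉≤V^n-step (n ∸ 6) (ih n∸6<n 24≤n∸6))
    where
    6≤n = ≤-trans (m≤n+m 6 18) 24≤n
    n∸6<n = ∸-monoʳ-< {o = 0} (s≤s z≤n) 6≤n
    24≤n∸6 = +-cancelʳ-≤ 6 24 (n ∸ 6) (subst (30 ≤_) (sym (m∸n+n≡m 6≤n)) (≮⇒≥ n≮30))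

lcmMultiple≤K*V^n : ∀ n → lcmMultiple n ≤ K * V ^ n
lcmMultiple≤K*V^n = <-rec _ go
  where
  go : ∀ n → (∀ {m} → m < n → lcmMultiple m ≤ K * V ^ m) → lcmMultiple n ≤ K * V ^ n
  go n ih with n <? 24
  ... | yes n<24 = ≤-trans (descendingProduct-mono-≤ chebyshev[30n]≤U^n n) (descendingProduct[U^]≤K*V^n n<24)
  ... | no  n≮24 = begin
    lcmMultiple n                          ≡⟨ lcmMultiple-unfold 2≤n ⟩
    chebyshev (n * 30) * lcmMultiple c     ≤⟨ *-mono-≤ (chebyshev[30n]≤U^n n) (ih (⌈n/6⌉<n 2≤n)) ⟩
    U ^ n * (K * V ^ c)                    ≡⟨ m*[n*o]≡n*[m*o] (U ^ n) K (V ^ c) ⟩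
    K * (U ^ n * V ^ c)                    ≤⟨ *-monoʳ-≤ K (U^n*V^⌈n/6⌉≤V^n (≮⇒≥ n≮24)) ⟩
    K * V ^ n                              ∎
    where
    open ≤-Reasoning
    c = ⌈ n /6⌉
    2≤n = ≤-trans (m≤n+m 2 22) (≮⇒≥ n≮24)

-- Primes in (90j, 120(j − 1)]

NoPrimeBetween : ℕ → ℕ → Set
NoPrimeBetween x y = ∀ {q} → Prime q → q ≤ x ⊎ y < q

noPrimeBetween⇒chebyshev∣lcmMultiple*lcmMultiple : ∀ a b c →
  NoPrimeBetween (a * 30) (b * 30) → b * 30 ≤ a * 30 * 2 → b * 30 < suc (c * 30) * suc (c * 30) →
  chebyshev (b * 30) ∣ lcmMultiple a * lcmMultiple c
noPrimeBetween⇒chebyshev∣lcmMultiple*lcmMultiple a b c noPrime 30b≤2*30a 30b<[1+30c]² =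
  ∣-by-valuations _ _ {{chebyshev≢0 (b * 30)}} {{m*n≢0 _ _ {{lcmMultiple≢0 a}} {{lcmMultiple≢0 c}}}} valuation≤
  where
  valuation≤ : ∀ {q} → Prime q → valuation q (chebyshev (b * 30)) ≤ valuation q (lcmMultiple a * lcmMultiple c)
  valuation≤ {q} qq = begin
    valuation q (chebyshev (b * 30))
      ≤⟨ valuation-chebyshev≤⌊log⌋ qq (b * 30) ⟩
    ⌊log⌋ q (b * 30)
      ≤⟨ ⌊log⌋-gap 1<q (a * 30) (b * 30) (c * 30) (noPrime qq) 30b≤30a*q 30b<[1+30c]² ⟩
    ⌊log⌋ q (a * 30) + ⌊log⌋ q (c * 30)
      ≤⟨ +-mono-≤ (⌊log⌋≤valuation-lcmMultiple qq a) (⌊log⌋≤valuation-lcmMultiple qq c) ⟩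
    valuation q (lcmMultiple a) + valuation q (lcmMultiple c)
      ≡⟨ valuation-* qq (lcmMultiple a) (lcmMultiple c) {{lcmMultiple≢0 a}} {{lcmMultiple≢0 c}} ⟨
    valuation q (lcmMultiple a * lcmMultiple c)
      ∎
    where
    open ≤-Reasoning
    instance
      q≢0 : NonZero q
      q≢0 = prime⇒nonZero qq
    1<q = nonTrivial⇒n>1 q {{prime⇒nonTrivial qq}}
    30b≤30a*q = ≤-trans 30b≤2*30a (*-monoʳ-≤ (a * 30) 1<q)

opaque
  unfolding ρ V K

  V≡2^51 : V ≡ 2 ^ 51
  V≡2^51 = refl

  2^156≤ρ^4 : 2 ^ 156 ≤ ρ ^ 4
  2^156≤ρ^4 = from-yes (2 ^ 156 ≤? ρ ^ 4)

  K*K*ρ^9<2^600 : K * K * ρ ^ 9 < 2 ^ 600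
  K*K*ρ^9<2^600 = from-yes (K * K * ρ ^ 9 <? 2 ^ 600)

lcmMultiple*lcmMultiple≤K*K*2^[155j] : ∀ j → lcmMultiple (j * 3) * lcmMultiple (j / 26) ≤ K * K * 2 ^ (j * 155)
lcmMultiple*lcmMultiple≤K*K*2^[155j] j = begin
  lcmMultiple a * lcmMultiple c   ≤⟨ *-mono-≤ (lcmMultiple≤K*V^n a) (lcmMultiple≤K*V^n c) ⟩
  (K * V ^ a) * (K * V ^ c)       ≡⟨ [m*n]*[o*p]≡[m*o]*[n*p] K (V ^ a) K (V ^ c) ⟩
  K * K * (V ^ a * V ^ c)         ≡⟨ cong (K * K *_) (^-distribˡ-+-* V a c) ⟨
  K * K * V ^ (a + c)             ≡⟨ cong (λ v → K * K * v ^ (a + c)) V≡2^51 ⟩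
  K * K * (2 ^ 51) ^ (a + c)      ≡⟨ cong (K * K *_) (^-*-assoc 2 51 (a + c)) ⟩
  K * K * 2 ^ (51 * (a + c))      ≤⟨ *-monoʳ-≤ (K * K) (^-monoʳ-≤ 2 51[a+c]≤155j) ⟩
  K * K * 2 ^ (j * 155)           ∎
  where
  open ≤-Reasoning
  a = j * 3
  c = j / 26
  51[a+c]≤155j : 51 * (a + c) ≤ j * 155
  51[a+c]≤155j = begin
    51 * (j * 3 + c)      ≡⟨ expand j c ⟩
    j * 153 + c * 51      ≤⟨ +-monoʳ-≤ (j * 153) (*-monoʳ-≤ c (n≤1+n 51)) ⟩
    j * 153 + c * 52      ≡⟨ cong (j * 153 +_) (*-assoc c 26 2) ⟨
    j * 153 + c * 26 * 2  ≤⟨ +-monoʳ-≤ (j * 153) (*-monoˡ-≤ 2 (m/n*n≤m j 26)) ⟩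
    j * 153 + j * 2       ≡⟨ collect j ⟩
    j * 155               ∎
    where
    expand : ∀ j c → 51 * (j * 3 + c) ≡ j * 153 + c * 51
    expand = solve-∀
    collect : ∀ j → j * 153 + j * 2 ≡ j * 155
    collect = solve-∀

2^[156j]≤ρ^9*chebyshev : ∀ j → 3 ≤ j → 2 ^ (j * 156) ≤ ρ ^ 9 * chebyshev (pred j * 4 * 30)
2^[156j]≤ρ^9*chebyshev j 3≤j = begin
  2 ^ (j * 156)                           ≡⟨ cong (2 ^_) (*-comm j 156) ⟩
  2 ^ (156 * j)                           ≡⟨ ^-*-assoc 2 156 j ⟨
  (2 ^ 156) ^ j                           ≤⟨ ^-monoˡ-≤ j 2^156≤ρ^4 ⟩
  (ρ ^ 4) ^ j                             ≡⟨ ^-*-assoc ρ 4 j ⟩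
  ρ ^ (4 * j)                             ≡⟨ cong (ρ ^_) 4j≡k+9 ⟩
  ρ ^ (k + 9)                             ≡⟨ ^-distribˡ-+-* ρ k 9 ⟩
  ρ ^ k * ρ ^ 9                           ≤⟨ *-monoˡ-≤ (ρ ^ 9) (ρ^k≤chebyshev[30[k+5]] k) ⟩
  chebyshev ((k + 5) * 30) * ρ ^ 9        ≡⟨ cong (λ m → chebyshev (m * 30) * ρ ^ 9) k+5≡4i ⟩
  chebyshev (i * 4 * 30) * ρ ^ 9          ≡⟨ *-comm (chebyshev (i * 4 * 30)) (ρ ^ 9) ⟩
  ρ ^ 9 * chebyshev (i * 4 * 30)          ∎
  where
  open ≤-Reasoning
  i = pred j
  k = i * 4 ∸ 5
  k+5≡4i : k + 5 ≡ i * 4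
  k+5≡4i = m∸n+n≡m {i * 4} {5} (≤-trans (m≤m+n 5 3) (*-monoˡ-≤ 4 (pred-mono-≤ 3≤j)))
  4j≡k+9 : 4 * j ≡ k + 9
  4j≡k+9 = begin-equality
    4 * j          ≡⟨ cong (4 *_) (suc-pred j {{>-nonZero (≤-trans (s≤s z≤n) 3≤j)}}) ⟨
    4 * suc i      ≡⟨ rearrange i ⟩
    i * 4 + 4      ≡⟨ cong (_+ 4) k+5≡4i ⟨
    k + 5 + 4      ≡⟨ +-assoc k 5 4 ⟩
    k + 9          ∎
    where
    rearrange : ∀ i → 4 * suc i ≡ i * 4 + 4
    rearrange = solve-∀

chebyshev≰lcmMultiple*lcmMultiple : ∀ j → 600 ≤ j →
  ¬ chebyshev (pred j * 4 * 30) ≤ lcmMultiple (j * 3) * lcmMultiple (j / 26)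
chebyshev≰lcmMultiple*lcmMultiple j 600≤j F≤M*M = <-irrefl refl (begin-strict
  2 ^ (j * 156)                        ≤⟨ 2^[156j]≤ρ^9*chebyshev j (≤-trans (m≤m+n 3 597) 600≤j) ⟩
  ρ ^ 9 * chebyshev (pred j * 4 * 30)  ≤⟨ *-monoʳ-≤ (ρ ^ 9) (≤-trans F≤M*M (lcmMultiple*lcmMultiple≤K*K*2^[155j] j)) ⟩
  ρ ^ 9 * (K * K * 2 ^ (j * 155))      ≡⟨ rearrange (ρ ^ 9) (K * K) (2 ^ (j * 155)) ⟩
  K * K * ρ ^ 9 * 2 ^ (j * 155)        <⟨ *-monoˡ-< (2 ^ (j * 155)) {{m^n≢0 2 (j * 155)}} K*K*ρ^9<2^600 ⟩
  2 ^ 600 * 2 ^ (j * 155)              ≤⟨ *-monoˡ-≤ (2 ^ (j * 155)) (^-monoʳ-≤ 2 600≤j) ⟩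
  2 ^ j * 2 ^ (j * 155)                ≡⟨ ^-distribˡ-+-* 2 j (j * 155) ⟨
  2 ^ (j + j * 155)                    ≡⟨ cong (2 ^_) (collect j) ⟩
  2 ^ (j * 156)                        ∎)
  where
  open ≤-Reasoning
  rearrange : ∀ r k t → r * (k * t) ≡ k * r * t
  rearrange = solve-∀
  collect : ∀ j → j + j * 155 ≡ j * 156
  collect = solve-∀

120[j-1]<[30⌊j/26⌋+1]² : ∀ j → 600 ≤ j → pred j * 4 * 30 < suc (j / 26 * 30) * suc (j / 26 * 30)
120[j-1]<[30⌊j/26⌋+1]² j 600≤j = begin-strict
  pred j * 4 * 30                 ≤⟨ *-monoˡ-≤ 30 (*-monoˡ-≤ 4 (pred[n]≤n {j})) ⟩
  j * 4 * 30                      ≡⟨ cong (λ t → t * 4 * 30) (trans (m≡m%n+[m/n]*n j 26) (+-comm (j % 26) (c * 26))) ⟩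
  (c * 26 + j % 26) * 4 * 30      ≤⟨ *-monoˡ-≤ 30 (*-monoˡ-≤ 4 (+-monoʳ-≤ (c * 26) (<⇒≤pred (m%n<n j 26)))) ⟩
  (c * 26 + 25) * 4 * 30          ≡⟨ expand c ⟩
  c * 3120 + 3000                 <⟨ +-monoʳ-< (c * 3120) (from-yes (3000 <? 17641)) ⟩
  c * 3120 + 17641                ≤⟨ +-monoʳ-≤ (c * 3120) (+-monoˡ-≤ 1 (*-monoˡ-≤ 17640 1≤c)) ⟩
  c * 3120 + (c * 17640 + 1)      ≡⟨ regroup c ⟩
  c * 23 * 900 + c * 60 + 1       ≤⟨ +-monoˡ-≤ 1 (+-monoˡ-≤ (c * 60) (*-monoˡ-≤ 900 (*-monoʳ-≤ c 23≤c))) ⟩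
  c * c * 900 + c * 60 + 1        ≡⟨ square c ⟩
  suc (c * 30) * suc (c * 30)     ∎
  where
  open ≤-Reasoning
  c = j / 26
  23≤c : 23 ≤ c
  23≤c = /-monoˡ-≤ 26 600≤j
  1≤c : 1 ≤ c
  1≤c = ≤-trans (s≤s z≤n) 23≤c
  expand : ∀ c → (c * 26 + 25) * 4 * 30 ≡ c * 3120 + 3000
  expand = solve-∀
  regroup : ∀ c → c * 3120 + (c * 17640 + 1) ≡ c * 23 * 900 + c * 60 + 1
  regroup = solve-∀
  square : ∀ c → c * c * 900 + c * 60 + 1 ≡ suc (c * 30) * suc (c * 30)
  square = solve-∀

primeBetween[90j,120[j-1]] : ∀ j → 600 ≤ j → ∃[ p ] Prime p × j * 3 * 30 < p × p ≤ pred j * 4 * 30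
primeBetween[90j,120[j-1]] j 600≤j with anyUpTo? (λ q → (a * 30 <? q) ×-dec prime? q) (suc (b * 30))
  where
  a = j * 3
  b = pred j * 4
... | yes (p , p<1+30b , 30a<p , prime-p) = p , prime-p , 30a<p , <⇒≤pred p<1+30b
... | no  noPrime = contradiction F≤M*M (chebyshev≰lcmMultiple*lcmMultiple j 600≤j)
  where
  a = j * 3
  b = pred j * 4
  c = j / 26
  noPrimeBetween : NoPrimeBetween (a * 30) (b * 30)
  noPrimeBetween {q} prime-q with q ≤? a * 30 | b * 30 <? q
  ... | yes q≤30a | _         = inj₁ q≤30a
  ... | no  _     | yes 30b<q = inj₂ 30b<q
  ... | no  q≰30a | no  30b≮q = contradiction (q , s≤s (≮⇒≥ 30b≮q) , ≰⇒> q≰30a , prime-q) noPrime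
  30b≤2*30a : b * 30 ≤ a * 30 * 2
  30b≤2*30a = begin
    pred j * 4 * 30   ≤⟨ *-monoˡ-≤ 30 (*-mono-≤ (pred[n]≤n {j}) (m≤m+n 4 2)) ⟩
    j * 6 * 30        ≡⟨ regroup j ⟩
    j * 3 * 30 * 2    ∎
    where
    open ≤-Reasoning
    regroup : ∀ j → j * 6 * 30 ≡ j * 3 * 30 * 2
    regroup = solve-∀
  F≤M*M : chebyshev (b * 30) ≤ lcmMultiple a * lcmMultiple c
  F≤M*M = ∣⇒≤ {{m*n≢0 _ _ {{lcmMultiple≢0 a}} {{lcmMultiple≢0 c}}}}
    (noPrimeBetween⇒chebyshev∣lcmMultiple*lcmMultiple a b c noPrimeBetween 30b≤2*30a (120[j-1]<[30⌊j/26⌋+1]² j 600≤j))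

-- Primes in (k, 4k/3)

PrimeIn⟨_,4/3⟩ : ℕ → Set
PrimeIn⟨ k ,4/3⟩ = ∃[ p ] Prime p × k < p × 3 * p < 4 * k

primeByTrialDivision : ∀ n r → 1 < n → (∀ {d} → d < r → 1 < d → ¬ d ∣ n) → n < r * r → Prime n
primeByTrialDivision n r 1<n noDivisor n<r² = rough∧square>⇒prime {{n>1⇒nonTrivial 1<n}} rough n<r²
  where
  rough : r Rough n
  rough (hasNonTrivialDivisor d<r d∣n) = noDivisor d<r (nonTrivial⇒n>1 _) d∣n

-- Only a search bound: the certificate below checks n < r * r itself.
1+⌊√_⌋ : ℕ → ℕ
1+⌊√ n ⌋ = search n 0
  where
  search : ℕ → ℕ → ℕ
  search zero    r = r
  search (suc f) r = if n <ᵇ r * r then r else search f (suc r)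

PrimeCertificate : ℕ → Set
PrimeCertificate n = 1 < n × (∀ {d} → d < 1+⌊√ n ⌋ → 1 < d → ¬ d ∣ n) × n < 1+⌊√ n ⌋ * 1+⌊√ n ⌋

primeCertificate? : ∀ n → Dec (PrimeCertificate n)
primeCertificate? n =
  (1 <? n) ×-dec allUpTo? (λ d → (1 <? d) →-dec ¬? (d ∣? n)) 1+⌊√ n ⌋ ×-dec (n <? 1+⌊√ n ⌋ * 1+⌊√ n ⌋)

primeCertificate⇒prime : ∀ {n} → PrimeCertificate n → Prime n
primeCertificate⇒prime {n} (1<n , noDivisor , n<r²) = primeByTrialDivision n 1+⌊√ n ⌋ 1<n noDivisor n<r²

primeIn⟨k,4/3⟩-by-chain : ∀ {p ps k} → All Prime ps → Linked (λ p q → 3 * q < 4 * p) (p ∷ ps) →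
                          p ≤ k → Any (k <_) ps → PrimeIn⟨ k ,4/3⟩
primeIn⟨k,4/3⟩-by-chain {p} {q ∷ qs} {k} (prime-q ∷ primes) (3q<4p ∷ linked) p≤k above with k <? q
... | yes k<q = q , prime-q , k<q , <-≤-trans 3q<4p (*-monoʳ-≤ 4 p≤k)
... | no  k≮q = primeIn⟨k,4/3⟩-by-chain primes linked (≮⇒≥ k≮q) (aboveLater above)
  where
  aboveLater : Any (k <_) (q ∷ qs) → Any (k <_) qs
  aboveLater (here k<q) = contradiction k<q k≮q
  aboveLater (there a)  = a

primeChain : List ℕ
primeChain =
  17 ∷ 19 ∷ 23 ∷ 29 ∷ 37 ∷ 47 ∷ 61 ∷ 79 ∷ 103 ∷ 137 ∷ 181 ∷ 241 ∷ 317 ∷ 421 ∷ 557 ∷ 739 ∷ 983 ∷ 1307 ∷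
  1741 ∷ 2311 ∷ 3079 ∷ 4099 ∷ 5449 ∷ 7253 ∷ 9661 ∷ 12853 ∷ 17137 ∷ 22817 ∷ 30403 ∷ 40531 ∷ 54037 ∷ []

primeIn⟨k,4/3⟩-small : ∀ {k} → 14 ≤ k → k < 54037 → PrimeIn⟨ k ,4/3⟩
primeIn⟨k,4/3⟩-small {k} 14≤k k<54037 = primeIn⟨k,4/3⟩-by-chain
  (All.map primeCertificate⇒prime (from-yes (all? primeCertificate? primeChain)))
  (from-yes (linked? (λ p q → 3 * q <? 4 * p) (13 ∷ primeChain)))
  (≤-trans (n≤1+n 13) 14≤k)
  (lose (from-yes (54037 ∈? primeChain)) k<54037)

primeIn⟨k,4/3⟩-large : ∀ {k} → 54037 ≤ k → PrimeIn⟨ k ,4/3⟩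
primeIn⟨k,4/3⟩-large {k@(suc k′)} 54037≤k with primeBetween[90j,120[j-1]] (suc i) 600≤1+i
  where
  i = k′ / 90
  600≤1+i = m≤n⇒m≤1+n (/-monoˡ-≤ 90 (≤-pred 54037≤k))
... | p , prime-p , 90[1+i]<p , p≤120i = p , prime-p , k<p , 3p<4k
  where
  open ≤-Reasoning
  i = k′ / 90
  k<p : k < p
  k<p = begin-strict
    suc k′           ≤⟨ s≤s (<⇒≤pred k′<90[1+i]) ⟩
    suc i * 90       ≡⟨ *-assoc (suc i) 3 30 ⟨
    suc i * 3 * 30   <⟨ 90[1+i]<p ⟩
    p                ∎
    where
    k′<90[1+i] : k′ < suc i * 90
    k′<90[1+i] = begin-strict
      k′                  ≡⟨ m≡m%n+[m/n]*n k′ 90 ⟩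
      k′ % 90 + i * 90    <⟨ +-monoˡ-< (i * 90) (m%n<n k′ 90) ⟩
      90 + i * 90         ∎
  3p<4k : 3 * p < 4 * k
  3p<4k = begin-strict
    3 * p              ≤⟨ *-monoʳ-≤ 3 p≤120i ⟩
    3 * (i * 4 * 30)   ≡⟨ regroup i ⟩
    4 * (i * 90)       <⟨ *-monoʳ-< 4 (s≤s (m/n*n≤m k′ 90)) ⟩
    4 * k              ∎
    where
    regroup : ∀ i → 3 * (i * 4 * 30) ≡ 4 * (i * 90)
    regroup = solve-∀

primeIn⟨k,4/3⟩ : ∀ {k} → 14 ≤ k → PrimeIn⟨ k ,4/3⟩
primeIn⟨k,4/3⟩ {k} 14≤k with k <? 54037
... | yes k<54037 = primeIn⟨k,4/3⟩-small 14≤k k<54037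
... | no  k≮54037 = primeIn⟨k,4/3⟩-large (≮⇒≥ k≮54037)

primeMultipleIn⟨u,4u/3⟩ : ∀ d u .{{_ : NonZero d}} → 14 * d ≤ u →
                          ∃[ p ] Prime p × u < d * p × 3 * (d * p) < 4 * u
primeMultipleIn⟨u,4u/3⟩ d u 14d≤u with primeIn⟨k,4/3⟩ 14≤u/d
  where 14≤u/d = subst (_≤ u / d) (m*n/n≡m 14 d) (/-monoˡ-≤ d 14d≤u)
... | p , prime-p , u/d<p , 3p<4[u/d] = p , prime-p , u<dp , 3dp<4u
  where
  open ≤-Reasoning
  k = u / d
  u<dp : u < d * p
  u<dp = begin-strict
    u               ≡⟨ m≡m%n+[m/n]*n u d ⟩
    u % d + k * d   <⟨ +-monoˡ-< (k * d) (m%n<n u d) ⟩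
    suc k * d       ≤⟨ *-monoˡ-≤ d u/d<p ⟩
    p * d           ≡⟨ *-comm p d ⟩
    d * p           ∎
  3dp<4u : 3 * (d * p) < 4 * u
  3dp<4u = begin-strict
    3 * (d * p)     ≡⟨ m*[n*o]≡n*[m*o] 3 d p ⟩
    d * (3 * p)     <⟨ *-monoʳ-< d 3p<4[u/d] ⟩
    d * (4 * k)     ≡⟨ m*[n*o]≡n*[m*o] d 4 k ⟩
    4 * (d * k)     ≡⟨ cong (4 *_) (*-comm d k) ⟩
    4 * (k * d)     ≤⟨ *-monoʳ-≤ 4 (m/n*n≤m u d) ⟩
    4 * u           ∎

72a<5n⇒14a≤n : ∀ a n → 72 * a < 5 * n → 14 * a ≤ n
72a<5n⇒14a≤n a n 72a<5n = <⇒≤ (*-cancelˡ-< 5 (14 * a) n (begin-strict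
  5 * (14 * a)   ≡⟨ *-assoc 5 14 a ⟨
  70 * a         ≤⟨ *-monoˡ-≤ a (m≤m+n 70 2) ⟩
  72 * a         <⟨ 72a<5n ⟩
  5 * n          ∎))
  where open ≤-Reasoning

14a≤n⇒14[2a]≤3n : ∀ a n → 14 * a ≤ n → 14 * (2 * a) ≤ 3 * n
14a≤n⇒14[2a]≤3n a n 14a≤n = begin
  14 * (2 * a)   ≡⟨ m*[n*o]≡n*[m*o] 14 2 a ⟩
  2 * (14 * a)   ≤⟨ *-monoʳ-≤ 2 14a≤n ⟩
  2 * n          ≤⟨ *-monoˡ-≤ n (m≤m+n 2 1) ⟩
  3 * n          ∎
  where open ≤-Reasoning

3x<4y⇒2x<3y : ∀ x y → 3 * x < 4 * y → 2 * x < 3 * y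
3x<4y⇒2x<3y x y 3x<4y = *-cancelˡ-< 3 (2 * x) (3 * y) (begin-strict
  3 * (2 * x)    ≡⟨ m*[n*o]≡n*[m*o] 3 2 x ⟩
  2 * (3 * x)    <⟨ *-monoʳ-< 2 3x<4y ⟩
  2 * (4 * y)    ≡⟨ *-assoc 2 4 y ⟨
  8 * y          ≤⟨ *-monoˡ-≤ y (m≤m+n 8 1) ⟩
  9 * y          ≡⟨ *-assoc 3 3 y ⟩
  3 * (3 * y)    ∎)
  where open ≤-Reasoning

3[2x]<4[3y]⇒x<2y : ∀ x y → 3 * (2 * x) < 4 * (3 * y) → x < 2 * y
3[2x]<4[3y]⇒x<2y x y 6x<12y = *-cancelˡ-< 6 x (2 * y) (begin-strict
  6 * x          ≡⟨ *-assoc 3 2 x ⟩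
  3 * (2 * x)    <⟨ 6x<12y ⟩
  4 * (3 * y)    ≡⟨ regroup y ⟩
  6 * (2 * y)    ∎)
  where
  open ≤-Reasoning
  regroup : ∀ y → 4 * (3 * y) ≡ 6 * (2 * y)
  regroup = solve-∀

theorem6p4 : (a n : ℕ) → 0 < a → 0 < n → 72 * a < 5 * n →
    Σ[ p ∈ ℕ ] Σ[ q ∈ ℕ ] (Prime p × Prime q ×
      n < a * p × 2 * (a * p) < 3 * n × 3 * n < 2 * (a * q) × a * q < 2 * n)
theorem6p4 a n 0<a _ 72a<5n =
  let p , prime-p , n<ap , 3ap<4n    = primeMultipleIn⟨u,4u/3⟩ a n 14a≤n
      q , prime-q , 3n<2aq , 6aq<12n = primeMultipleIn⟨u,4u/3⟩ (2 * a) (3 * n) (14a≤n⇒14[2a]≤3n a n 14a≤n)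
  in p , q , prime-p , prime-q , n<ap , 3x<4y⇒2x<3y (a * p) n 3ap<4n ,
     subst (3 * n <_) (*-assoc 2 a q) 3n<2aq ,
     3[2x]<4[3y]⇒x<2y (a * q) n (subst (λ x → 3 * x < 4 * (3 * n)) (*-assoc 2 a q) 6aq<12n)
  where
  instance
    a≢0 : NonZero a
    a≢0 = >-nonZero 0<a
    2a≢0 : NonZero (2 * a)
    2a≢0 = m*n≢0 2 a
  14a≤n = 72a<5n⇒14a≤n a n 72a<5n
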